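{- Let $k\in\mathbb{N}$ be fixed. Then, as $x$ ranges over $\mathbb{N}\setminus\{1\}$, the number of distinct loops occurring in the sequences $S(x,k)$ is finite.
   Context: For $k\in\mathbb{N}$, define $\varphi_k:\mathbb{N}\setminus\{1\}\to\mathbb{N}\setminus\{1\}$ by $\varphi_k(x)=x+k$ if $x$ is prime, and $\varphi_k(x)=$ the largest prime divisor of $x$ if $x$ is composite. For $x_0\in\mathbb{N}\setminus\{1\}$, $S(x_0,k)$ denotes the sequence $x_0,\varphi_k(x_0),\varphi_k^2(x_0),\dots$, which is eventually periodic: there exist $m,l$ with $\varphi_k^i(x_0)=\varphi_k^{i+l}(x_0)$ for all $i\ge m$. With $l$ the smallest such value (the period), any $l$ consecutive terms of $\varphi_k^m(x_0),\varphi_k^{m+1}(x_0),\dots$ is called a loop (cycle) of the sequence; loops differing only by a cyclic shift are regarded as the same loop. -}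

module Defs where

open import Data.Nat using (ℕ; zero; suc; _+_; _≤_; _<_)
open import Data.Nat.Divisibility using (_∣_; _∣?_)
open import Data.Nat.Primality using (Prime; prime?)
open import Data.List using (List; []; _∷_; length; drop; take; _++_)
open import Data.Product using (Σ; _×_; ∃; ∃-syntax)
open import Relation.Nullary using (yes; no)
open import Relation.Nullary.Decidable using (_×-dec_)
open import Relation.Binary.PropositionalEquality using (_≡_)

-- largestPrimeDivisorUpTo x d : the largest prime p ≤ d with p ∣ x
-- (junk value 1 if there is none).
largestPrimeDivisorUpTo : ℕ → ℕ → ℕ
largestPrimeDivisorUpTo x zero = 1
largestPrimeDivisorUpTo x (suc d) with prime? (suc d) ×-dec (suc d ∣? x)
... | yes _ = suc d
... | no  _ = largestPrimeDivisorUpTo x d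

largestPrimeDivisor : ℕ → ℕ
largestPrimeDivisor x = largestPrimeDivisorUpTo x x

-- φ_k : x ↦ x + k if x prime, largest prime divisor of x otherwise
-- (only used on ℕ ∖ {0,1}, where "not prime" means composite)
φ : ℕ → ℕ → ℕ
φ k x with prime? x
... | yes _ = x + k
... | no  _ = largestPrimeDivisor x

φ^ : ℕ → ℕ → ℕ → ℕ
φ^ k zero    x = x
φ^ k (suc n) x = φ k (φ^ k n x)

segment : ℕ → ℕ → ℕ → ℕ → List ℕ
segment k x m zero    = []
segment k x m (suc l) = φ^ k m x ∷ segment k x (suc m) l

IsPeriodFrom : ℕ → ℕ → ℕ → ℕ → Set
IsPeriodFrom k x m l = ∀ i → m ≤ i → φ^ k i x ≡ φ^ k (i + l) x

IsEventualPeriod : ℕ → ℕ → ℕ → Set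
IsEventualPeriod k x l = 0 < l × ∃[ m ] IsPeriodFrom k x m l

IsLoop : ℕ → ℕ → List ℕ → Set
IsLoop k x ℓ =
  Σ ℕ λ m → IsPeriodFrom k x m (length ℓ)
          × 0 < length ℓ
          × (∀ l′ → IsEventualPeriod k x l′ → length ℓ ≤ l′)
          × ℓ ≡ segment k x m (length ℓ)

rotate : ℕ → List ℕ → List ℕ
rotate i ℓ = drop i ℓ ++ take i ℓ

SameLoop : List ℕ → List ℕ → Set
SameLoop ℓ ℓ′ = ∃[ i ] ℓ ≡ rotate i ℓ′

-- On a cycle of φ_k, consider its maximum M. It cannot be prime (its successor M + k would be
-- larger), so the cycle reaches M from the last composite z before it: φ_k z = q is the largest
-- prime divisor of z, hence q ≤ z/2 ≤ M/2, and then J steps of adding k through primes give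
-- M = q + J k. Among q, q + k, …, q + (J-1) k, which are all prime, the term q + u k with
-- u ≡ q (mod k+1) is divisible by k + 1, so it is k + 1 itself, and u + k + 1 steps later we
-- would reach (k+1)²; thus J ≤ 2k + 1 and M ≤ 2 J k ≤ 2 (2k+1) k. Every cycle therefore lives
-- below this bound and, by pigeonhole, has length at most bound + 1, leaving finitely many cycles.
module Submission where

open import Defs
open import Data.Fin using (toℕ; fromℕ<)
open import Data.Fin.Properties using (pigeonhole; toℕ-fromℕ<; toℕ<n)
open import Data.List using (List; []; _∷_; length; upTo; cartesianProductWith)
open import Data.List.Membership.Propositional using (_∈_)
open import Data.List.Membership.Propositional.Properties using (∈-cartesianProductWith⁺; ∈-upTo⁺)
open import Data.List.Properties using (++-identityʳ)
open import Data.List.Relation.Unary.All using (_∷_)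
open import Data.Nat
open import Data.Nat.DivMod using (_%_; _/_; m%n<n; m≡m%n+[m/n]*n)
open import Data.Nat.Divisibility
open import Data.Nat.ListAction using (product)
open import Data.Nat.Primality
open import Data.Nat.Primality.Factorisation using (factorise)
open import Data.Nat.Properties
open import Algebra.Properties.CommutativeSemigroup +-commutativeSemigroup using (x∙yz≈xz∙y; xy∙z≈xz∙y)
open import Data.Nat.Tactic.RingSolver using (solve-∀)
open import Data.Product using (Σ; ∃-syntax; ∃₂; _×_; _,_; proj₁)
open import Data.Sum using (_⊎_; inj₁; inj₂)
open import Relation.Nullary using (¬_; yes; no; contradiction)
open import Relation.Nullary.Decidable using (_×-dec_)
open import Relation.Unary using (Decidable)
open import Relation.Binary.PropositionalEquality

prime⇒2≤ : ∀ {p} → Prime p → 2 ≤ p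
prime⇒2≤ {p} pp = nonTrivial⇒n>1 p {{prime⇒nonTrivial pp}}

prime-∣⇒≡ : ∀ {d p} → 2 ≤ d → Prime p → d ∣ p → d ≡ p
prime-∣⇒≡ 2≤d pp d∣p with prime⇒irreducible pp d∣p
... | inj₁ refl = contradiction 2≤d λ { (s≤s ()) }
... | inj₂ d≡p  = d≡p

¬prime-n*n : ∀ {n} → 2 ≤ n → ¬ Prime (n * n)
¬prime-n*n {n@(suc _)} 2≤n pnn = <⇒≢ (m<m*n n n 2≤n) (prime-∣⇒≡ 2≤n pnn (m∣m*n n))

∃-prime-∣ : ∀ {n} → 2 ≤ n → ∃[ p ] Prime p × p ∣ n
∃-prime-∣ {n@(suc _)} 2≤n with factorise n
... | record { factors = [] ; isFactorisation = n≡1 } =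
  contradiction (≤-trans 2≤n (≤-reflexive n≡1)) λ { (s≤s ()) }
... | record { factors = p ∷ ps ; isFactorisation = n≡p*Πps ; factorsPrime = pp ∷ _ } =
  p , pp , divides (product ps) (trans n≡p*Πps (*-comm p (product ps)))

∣∧≢⇒2*≤ : ∀ {d n} .{{_ : NonZero n}} → d ∣ n → d ≢ n → 2 * d ≤ n
∣∧≢⇒2*≤ {d} {n} d∣n d≢n = begin
  2 * d            ≤⟨ *-monoˡ-≤ d (quotient>1 d∣n (≤∧≢⇒< (∣⇒≤ d∣n) d≢n)) ⟩
  quotient d∣n * d ≡⟨ m∣n⇒n≡quotient*m d∣n ⟨
  n                ∎
  where open ≤-Reasoning

largestPrimeDivisorUpTo-spec : ∀ x d →
  (Prime (largestPrimeDivisorUpTo x d) × largestPrimeDivisorUpTo x d ∣ x) ⊎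
  (∀ {p} → p ≤ d → Prime p → ¬ p ∣ x)
largestPrimeDivisorUpTo-spec x zero = inj₂ λ { z≤n () }
largestPrimeDivisorUpTo-spec x (suc d) with prime? (suc d) ×-dec (suc d ∣? x)
... | yes found = inj₁ found
... | no ¬found with largestPrimeDivisorUpTo-spec x d
...   | inj₁ found = inj₁ found
...   | inj₂ none  = inj₂ none≤1+d
  where
  none≤1+d : ∀ {p} → p ≤ suc d → Prime p → ¬ p ∣ x
  none≤1+d p≤1+d pp p∣x with m≤n⇒m<n∨m≡n p≤1+d
  ... | inj₁ p<1+d = none (s≤s⁻¹ p<1+d) pp p∣x
  ... | inj₂ refl  = ¬found (pp , p∣x)

largestPrimeDivisor-prime×∣ : ∀ {x} → 2 ≤ x → Prime (largestPrimeDivisor x) × largestPrimeDivisor x ∣ x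
largestPrimeDivisor-prime×∣ {x@(suc _)} 2≤x with largestPrimeDivisorUpTo-spec x x
... | inj₁ found = found
... | inj₂ none with p , pp , p∣x ← ∃-prime-∣ 2≤x = contradiction p∣x (none (∣⇒≤ p∣x) pp)

largestPrimeDivisor-half : ∀ {x} → 2 ≤ x → ¬ Prime x → 2 * largestPrimeDivisor x ≤ x
largestPrimeDivisor-half {x@(suc _)} 2≤x ¬px with pp , p∣x ← largestPrimeDivisor-prime×∣ 2≤x =
  ∣∧≢⇒2*≤ p∣x λ p≡x → ¬px (subst Prime p≡x pp)

-- Since k ≡ -1 (mod k+1), the term with u = q mod (k+1) is divisible by k + 1, hence equals
-- k + 1, and then the term with u = q mod (k+1) + (k+1) is (k+1)².
primeProgression-length : ∀ {k q J} → 1 ≤ k → (∀ {u} → u < J → Prime (q + u * k)) → J ≤ 2 * k + 1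
primeProgression-length {k} {q} {J} 1≤k primes = begin
  J          ≤⟨ ≮⇒≥ ¬u₀+r<J ⟩
  u₀ + r     ≤⟨ +-monoˡ-≤ r (s≤s⁻¹ (m%n<n q r)) ⟩
  k + suc k  ≡⟨ twice+1 k ⟩
  2 * k + 1  ∎
  where
  open ≤-Reasoning
  r  = suc k
  u₀ = q % r

  twice+1 : ∀ k → k + suc k ≡ 2 * k + 1
  twice+1 = solve-∀

  r∣q+u₀k : r ∣ q + u₀ * k
  r∣q+u₀k = divides (q / r + u₀) (trans (cong (_+ u₀ * k) (m≡m%n+[m/n]*n q r)) (regroup (q / r) u₀ k))
    where
    regroup : ∀ a u k → u + a * suc k + u * k ≡ (a + u) * suc k
    regroup = solve-∀

  ¬u₀+r<J : ¬ u₀ + r < J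
  ¬u₀+r<J u₀+r<J = ¬prime-n*n (s≤s 1≤k) (subst Prime r²-term (primes u₀+r<J))
    where
    q+u₀k≡r : q + u₀ * k ≡ r
    q+u₀k≡r = sym (prime-∣⇒≡ (s≤s 1≤k) (primes (≤-<-trans (m≤m+n u₀ r) u₀+r<J)) r∣q+u₀k)

    r²-term : q + (u₀ + r) * k ≡ r * r
    r²-term = begin-equality
      q + (u₀ + r) * k     ≡⟨ cong (q +_) (*-distribʳ-+ k u₀ r) ⟩
      q + (u₀ * k + r * k) ≡⟨ +-assoc q (u₀ * k) (r * k) ⟨
      q + u₀ * k + r * k   ≡⟨ cong (_+ r * k) q+u₀k≡r ⟩
      r + r * k            ≡⟨ *-suc r k ⟨
      r * r                ∎

Periodic : (ℕ → ℕ) → ℕ → Set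
Periodic f l = ∀ n → f (n + l) ≡ f n

periodic-* : ∀ {f l} → Periodic f l → ∀ c n → f (n + c * l) ≡ f n
periodic-* {f} per zero    n = cong f (+-identityʳ n)
periodic-* {f} {l} per (suc c) n = begin
  f (n + (l + c * l)) ≡⟨ cong f (x∙yz≈xz∙y n l (c * l)) ⟩
  f (n + c * l + l)   ≡⟨ per (n + c * l) ⟩
  f (n + c * l)       ≡⟨ periodic-* per c n ⟩
  f n                 ∎
  where open ≡-Reasoning

periodic-% : ∀ {f l} .{{_ : NonZero l}} → Periodic f l → ∀ n → f n ≡ f (n % l)
periodic-% {f} {l} per n =
  trans (cong f (m≡m%n+[m/n]*n n l)) (periodic-* per (n / l) (n % l))

∀≤-suc : ∀ {g : ℕ → ℕ} {n c} → (∀ {i} → i ≤ n → g i ≤ c) → g (suc n) ≤ c →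
         ∀ {i} → i ≤ suc n → g i ≤ c
∀≤-suc below top i≤1+n with m≤n⇒m<n∨m≡n i≤1+n
... | inj₁ i<1+n = below (s≤s⁻¹ i<1+n)
... | inj₂ refl  = top

argmax≤ : ∀ (f : ℕ → ℕ) n → ∃[ t ] (∀ {i} → i ≤ n → f i ≤ f t)
argmax≤ f zero = 0 , λ { z≤n → ≤-refl }
argmax≤ f (suc n) with t , max ← argmax≤ f n with f (suc n) ≤? f t
... | yes top = t , ∀≤-suc max top
... | no ¬top  = suc n , ∀≤-suc (λ i≤n → ≤-trans (max i≤n) (<⇒≤ (≰⇒> ¬top))) ≤-refl

periodic⇒∃max : ∀ {f l} .{{_ : NonZero l}} → Periodic f l → ∃[ t ] (∀ n → f n ≤ f t)
periodic⇒∃max {f} {suc d} per with t , max ← argmax≤ f d =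
  t , λ n → subst (_≤ f t) (sym (periodic-% per n)) (max (s≤s⁻¹ (m%n<n n (suc d))))

lastFailure : ∀ {P : ℕ → Set} → Decidable P → ∀ {t} → ¬ P t → ∀ d →
  ∃₂ λ s J → J + s ≡ t + d × ¬ P s × (∀ {u} → u < J → P (u + suc s))
lastFailure P? {t} ¬Pt zero = t , 0 , sym (+-identityʳ t) , ¬Pt , λ ()
lastFailure P? {t} ¬Pt (suc d) with P? (t + suc d)
... | no ¬Pt+1+d = t + suc d , 0 , refl , ¬Pt+1+d , λ ()
lastFailure {P} P? {t} ¬Pt (suc d) | yes Pt+1+d
  with s , J , J+s≡t+d , ¬Ps , after ← lastFailure P? ¬Pt d =
  s , suc J , trans (cong suc J+s≡t+d) (sym (+-suc t d)) , ¬Ps , after′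
  where
  after′ : ∀ {u} → u < suc J → P (u + suc s)
  after′ u<1+J with m<1+n⇒m<n∨m≡n u<1+J
  ... | inj₁ u<J  = after u<J
  ... | inj₂ refl = subst P (sym J+1+s≡t+1+d) Pt+1+d
    where
    J+1+s≡t+1+d : J + suc s ≡ t + suc d
    J+1+s≡t+1+d = trans (+-suc J s) (trans (cong suc J+s≡t+d) (sym (+-suc t d)))

φ-prime : ∀ {k x} → Prime x → φ k x ≡ x + k
φ-prime {k} {x} px with prime? x
... | yes _  = refl
... | no ¬px = contradiction px ¬px

φ-¬prime : ∀ {k x} → ¬ Prime x → φ k x ≡ largestPrimeDivisor x
φ-¬prime {k} {x} ¬px with prime? x
... | yes px = contradiction px ¬px
... | no _   = refl

φ-≥2 : ∀ {k x} → 2 ≤ x → 2 ≤ φ k x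
φ-≥2 {k} {x} 2≤x with prime? x
... | yes _ = ≤-trans 2≤x (m≤m+n x k)
... | no _  = prime⇒2≤ (proj₁ (largestPrimeDivisor-prime×∣ 2≤x))

φ^-≥2 : ∀ {k x} → 2 ≤ x → ∀ n → 2 ≤ φ^ k n x
φ^-≥2 2≤x zero    = 2≤x
φ^-≥2 2≤x (suc n) = φ-≥2 (φ^-≥2 2≤x n)

φ^-+ : ∀ k m n x → φ^ k m (φ^ k n x) ≡ φ^ k (m + n) x
φ^-+ k zero    n x = refl
φ^-+ k (suc m) n x = cong (φ k) (φ^-+ k m n x)

primeRun-linear : ∀ {k w J} → (∀ {u} → u < J → Prime (φ^ k u w)) →
                  ∀ {u} → u ≤ J → φ^ k u w ≡ w + u * k
primeRun-linear {k} {w} run {zero}  _     = sym (+-identityʳ w)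
primeRun-linear {k} {w} run {suc u} 1+u≤J = begin
  φ k (φ^ k u w)   ≡⟨ φ-prime (run 1+u≤J) ⟩
  φ^ k u w + k     ≡⟨ cong (_+ k) (primeRun-linear run (<⇒≤ 1+u≤J)) ⟩
  w + u * k + k    ≡⟨ +-assoc w (u * k) k ⟩
  w + (u * k + k)  ≡⟨ cong (w +_) (+-comm (u * k) k) ⟩
  w + suc u * k    ∎
  where open ≡-Reasoning

orbitBound : ℕ → ℕ
orbitBound k = 2 * ((2 * k + 1) * k)

primeRunAfterComposite-bounded : ∀ {k z J} → 1 ≤ k → 2 ≤ z → ¬ Prime z →
  (∀ {u} → u < J → Prime (φ^ k u (φ k z))) → z ≤ φ^ k J (φ k z) →
  φ^ k J (φ k z) ≤ orbitBound k
primeRunAfterComposite-bounded {k} {z} {J} 1≤k 2≤z ¬pz run z≤end = begin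
  φ^ k J q          ≡⟨ end≡ ⟩
  q + J * k         ≤⟨ +-monoˡ-≤ (J * k) q≤Jk ⟩
  J * k + J * k     ≡⟨ cong (J * k +_) (+-identityʳ (J * k)) ⟨
  2 * (J * k)       ≤⟨ *-monoʳ-≤ 2 (*-monoˡ-≤ k (primeProgression-length 1≤k progression)) ⟩
  orbitBound k      ∎
  where
  open ≤-Reasoning
  q = φ k z

  end≡ : φ^ k J q ≡ q + J * k
  end≡ = primeRun-linear run ≤-refl

  progression : ∀ {u} → u < J → Prime (q + u * k)
  progression u<J = subst Prime (primeRun-linear run (<⇒≤ u<J)) (run u<J)

  2q≤z : 2 * q ≤ z
  2q≤z = subst (λ p → 2 * p ≤ z) (sym (φ-¬prime ¬pz)) (largestPrimeDivisor-half 2≤z ¬pz)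

  q≤Jk : q ≤ J * k
  q≤Jk = +-cancelˡ-≤ q q (J * k) (begin
    q + q       ≡⟨ cong (q +_) (+-identityʳ q) ⟨
    2 * q       ≤⟨ 2q≤z ⟩
    z           ≤⟨ z≤end ⟩
    φ^ k J q    ≡⟨ end≡ ⟩
    q + J * k   ∎)

orbitMax-¬prime : ∀ {k y t} → 1 ≤ k → (∀ n → φ^ k n y ≤ φ^ k t y) → ¬ Prime (φ^ k t y)
orbitMax-¬prime {k} {y} {t} 1≤k max pM =
  <⇒≱ (subst (φ^ k t y <_) (sym (φ-prime pM)) (m<m+n (φ^ k t y) 1≤k)) (max (suc t))

periodicOrbit-bounded : ∀ {k y l} → 1 ≤ k → 2 ≤ y → .{{_ : NonZero l}} →
  Periodic (λ n → φ^ k n y) l → ∀ n → φ^ k n y ≤ orbitBound k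
periodicOrbit-bounded {k} {y} {l@(suc d)} 1≤k 2≤y per n
  with t , max ← periodic⇒∃max per
  with s , J , J+s≡t+d , ¬prime-s , primes
         ← lastFailure (λ i → prime? (φ^ k i y)) {t} (orbitMax-¬prime {t = t} 1≤k max) d
  = begin
    φ^ k n y                 ≤⟨ max n ⟩
    φ^ k t y                 ≡⟨ runEnd≡max ⟨
    φ^ k J (φ k (φ^ k s y))  ≤⟨ primeRunAfterComposite-bounded 1≤k (φ^-≥2 2≤y s) ¬prime-s run
                                 (subst (φ^ k s y ≤_) (sym runEnd≡max) (max s)) ⟩
    orbitBound k             ∎
  where
  open ≤-Reasoning

  run : ∀ {u} → u < J → Prime (φ^ k u (φ k (φ^ k s y)))
  run {u} u<J = subst Prime (sym (φ^-+ k u (suc s) y)) (primes u<J)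

  runEnd≡max : φ^ k J (φ k (φ^ k s y)) ≡ φ^ k t y
  runEnd≡max = begin-equality
    φ^ k J (φ^ k (suc s) y) ≡⟨ φ^-+ k J (suc s) y ⟩
    φ^ k (J + suc s) y      ≡⟨ cong (λ i → φ^ k i y) (+-suc J s) ⟩
    φ^ k (suc (J + s)) y    ≡⟨ cong (λ i → φ^ k (suc i) y) J+s≡t+d ⟩
    φ^ k (suc (t + d)) y    ≡⟨ cong (λ i → φ^ k i y) (+-suc t d) ⟨
    φ^ k (t + l) y          ≡⟨ per t ⟩
    φ^ k t y                ∎

isPeriodFrom⇒periodic : ∀ {k x m l} → IsPeriodFrom k x m l → Periodic (λ n → φ^ k n (φ^ k m x)) l
isPeriodFrom⇒periodic {k} {x} {m} {l} per n = begin
  φ^ k (n + l) (φ^ k m x) ≡⟨ φ^-+ k (n + l) m x ⟩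
  φ^ k (n + l + m) x      ≡⟨ cong (λ i → φ^ k i x) (xy∙z≈xz∙y n l m) ⟩
  φ^ k (n + m + l) x      ≡⟨ per (n + m) (m≤n+m m n) ⟨
  φ^ k (n + m) x          ≡⟨ φ^-+ k n m x ⟨
  φ^ k n (φ^ k m x)       ∎
  where open ≡-Reasoning

repeat⇒isPeriodFrom : ∀ {k x i p} → φ^ k i x ≡ φ^ k (i + p) x → IsPeriodFrom k x i p
repeat⇒isPeriodFrom {k} {x} {i} {p} repeat w i≤w = begin
  φ^ k w x                 ≡⟨ cong (λ j → φ^ k j x) w≡c+i ⟩
  φ^ k (c + i) x           ≡⟨ φ^-+ k c i x ⟨
  φ^ k c (φ^ k i x)        ≡⟨ cong (φ^ k c) repeat ⟩
  φ^ k c (φ^ k (i + p) x)  ≡⟨ φ^-+ k c (i + p) x ⟩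
  φ^ k (c + (i + p)) x     ≡⟨ cong (λ j → φ^ k j x) (+-assoc c i p) ⟨
  φ^ k (c + i + p) x       ≡⟨ cong (λ j → φ^ k (j + p) x) w≡c+i ⟨
  φ^ k (w + p) x           ∎
  where
  open ≡-Reasoning
  c = w ∸ i
  w≡c+i : w ≡ c + i
  w≡c+i = sym (m∸n+n≡m i≤w)

bounded⇒repeats : ∀ {f : ℕ → ℕ} {B} → (∀ n → f n ≤ B) →
  ∃₂ λ i p → 0 < p × i + p ≤ suc B × f i ≡ f (i + p)
bounded⇒repeats {f} {B} bounded
  with i , j , i<j , gi≡gj ← pigeonhole ≤-refl (λ i → fromℕ< (s≤s (bounded (toℕ i))))
  = toℕ i , toℕ j ∸ toℕ i , m<n⇒0<n∸m i<j , ≤-trans (≤-reflexive i+p≡j) (s≤s⁻¹ (toℕ<n j)) ,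
    subst (λ n → f (toℕ i) ≡ f n) (sym i+p≡j) fi≡fj
  where
  i+p≡j : toℕ i + (toℕ j ∸ toℕ i) ≡ toℕ j
  i+p≡j = m+[n∸m]≡n (<⇒≤ i<j)

  fi≡fj : f (toℕ i) ≡ f (toℕ j)
  fi≡fj = trans (sym (toℕ-fromℕ< _)) (trans (cong toℕ gi≡gj) (toℕ-fromℕ< _))

boundedOrbit⇒eventualPeriod≤ : ∀ {k x m B} → (∀ n → φ^ k n (φ^ k m x) ≤ B) →
  ∃[ p ] IsEventualPeriod k x p × p ≤ suc B
boundedOrbit⇒eventualPeriod≤ {k} {x} {m} {B} bounded =
  let i , p , 0<p , i+p≤1+B , repeat = bounded⇒repeats bounded
      repeat′ : φ^ k (i + m) x ≡ φ^ k (i + m + p) x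
      repeat′ = begin
        φ^ k (i + m) x          ≡⟨ φ^-+ k i m x ⟨
        φ^ k i (φ^ k m x)       ≡⟨ repeat ⟩
        φ^ k (i + p) (φ^ k m x) ≡⟨ φ^-+ k (i + p) m x ⟩
        φ^ k (i + p + m) x      ≡⟨ cong (λ j → φ^ k j x) (xy∙z≈xz∙y i p m) ⟩
        φ^ k (i + m + p) x      ∎
  in p , (0<p , i + m , repeat⇒isPeriodFrom repeat′) , ≤-trans (m≤n+m p i) i+p≤1+B
  where open ≡-Reasoning

segment-shift : ∀ k x m n l → segment k x (n + m) l ≡ segment k (φ^ k m x) n l
segment-shift k x m n zero    = refl
segment-shift k x m n (suc l) = cong₂ _∷_ (sym (φ^-+ k n m x)) (segment-shift k x m (suc n) l)

loop-bounded : ∀ {k x ℓ} → 1 ≤ k → 2 ≤ x → IsLoop k x ℓ →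
  ∃[ y ] y ≤ orbitBound k × length ℓ ≤ suc (orbitBound k) × ℓ ≡ segment k y 0 (length ℓ)
loop-bounded {k} {x} {ℓ} 1≤k 2≤x (m , per , 0<l , minimal , ℓ≡segment) =
  let p , period , p≤1+B = boundedOrbit⇒eventualPeriod≤ {m = m} bounded
  in φ^ k m x , bounded 0 , ≤-trans (minimal p period) p≤1+B ,
     trans ℓ≡segment (segment-shift k x m 0 (length ℓ))
  where
  bounded : ∀ n → φ^ k n (φ^ k m x) ≤ orbitBound k
  bounded = periodicOrbit-bounded 1≤k (φ^-≥2 2≤x m) {{>-nonZero 0<l}} (isPeriodFrom⇒periodic per)

candidateLoops : ℕ → List (List ℕ)
candidateLoops k = cartesianProductWith (λ y l → segment k y 0 l) (upTo (suc B)) (upTo (suc (suc B)))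
  where B = orbitBound k

SameLoop-refl : ∀ ℓ → SameLoop ℓ ℓ
SameLoop-refl ℓ = 0 , sym (++-identityʳ ℓ)

mainTheorem3 : (k : ℕ) → 1 ≤ k →
    Σ (List (List ℕ)) λ L →
      ∀ (x : ℕ) → 2 ≤ x → ∀ (ℓ : List ℕ) → IsLoop k x ℓ →
        Σ (List ℕ) λ ℓ′ → ℓ′ ∈ L × SameLoop ℓ ℓ′
mainTheorem3 k 1≤k = candidateLoops k , λ x 2≤x ℓ isLoop →
  let y , y≤B , l≤1+B , ℓ≡segment = loop-bounded 1≤k 2≤x isLoop
  in ℓ , subst (_∈ candidateLoops k) (sym ℓ≡segment)
               (∈-cartesianProductWith⁺ (λ y l → segment k y 0 l) (∈-upTo⁺ (s≤s y≤B)) (∈-upTo⁺ (s≤s l≤1+B))) ,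
     SameLoop-refl ℓ
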